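{- Let $G$ be a graph, let $R\in\mathbb{N}_{\ge0}$, $\phi,\psi\in(0,1)$, and let $\boldsymbol{\gamma}\in\mathbb{N}_{\ge0}^{V(G)}$ be any vector. If there exists an $(R,\phi,\psi)$-witness $W$ (with embedding $\Pi_{W\mapsto G}$) of $(G,\boldsymbol{0})$ with respect to $\boldsymbol{\gamma}$, then $G$ is a $\psi^2\phi$-expander.
   Context: Graphs are directed unweighted multi-graphs; $\deg_G(v)$ is the number of incident edges (self-loop counts 2), $\mathrm{vol}_G(S)=\sum_{v\in S}\deg_G(v)$, $E_G(S,\overline{S})$ is the set of edges with tail in $S$ and head in $\overline{S}=V\setminus S$, and $\overleftarrow{G}$ is $G$ with edges reversed. For a vector $\boldsymbol{r}$, $\boldsymbol{r}(S)=\sum_{s\in S}\boldsymbol{r}(s)$. A cut $(S,\overline{S})$ is $\phi$-out-sparse if $\mathrm{vol}_G(S)\le\mathrm{vol}_G(\overline{S})$ and $|E_G(S,\overline{S})|<\phi\,\mathrm{vol}_G(S)$; $G$ is a $\phi$-expander if neither $G$ nor $\overleftarrow{G}$ has a $\phi$-out-sparse cut. For graphs $G,W$ on the same vertex set, an embedding $\Pi_{W\mapsto G}$ maps each edge $(u,v)\in E(W)$ to a $u$-to-$v$ path in $G$; its congestion is the maximum over $e\in E(G)$ of the number of edges of $W$ whose path contains $e$. Given $\boldsymbol{r},\boldsymbol{\gamma}\in\mathbb{N}_{\ge0}^{V(G)}$, $\phi,\psi\in(0,1)$, $R\in\mathbb{N}_{\ge0}$, the pair $(W,\Pi_{W\mapsto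 G})$ is an $(R,\phi,\psi)$-out-witness of $(G,\boldsymbol{r})$ with respect to $\boldsymbol{\gamma}$ if: (1) $\|\boldsymbol{r}\|_1\le R$; (2) for all $v$, $\deg_W(v)+\boldsymbol{r}(v)\in[\deg_G(v),\frac{1}{\psi}\deg_G(v)]$; (3) for every $S\subseteq V$ with $\boldsymbol{\gamma}(S)\le\boldsymbol{\gamma}(\overline{S})$, $|E_W(S,\overline{S})|+\boldsymbol{r}(S)\ge\psi(\mathrm{vol}_W(S)+\boldsymbol{r}(S))$; (4) $\Pi_{W\mapsto G}$ has congestion at most $\frac{1}{\psi\phi}$. It is an $(R,\phi,\psi)$-witness of $(G,\boldsymbol{r})$ w.r.t. $\boldsymbol{\gamma}$ if additionally $\overleftarrow{W}$ (with the reversed embedding) is an $(R,\phi,\psi)$-out-witness of $(\overleftarrow{G},\boldsymbol{r})$ w.r.t. $\boldsymbol{\gamma}$. -}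

module Defs where

open import Data.Nat as ℕ using (ℕ; zero; suc)
open import Data.Fin using (Fin; zero; suc; _≟_)
open import Data.Fin.Subset using (Subset; ∁)
open import Data.Bool using (Bool; true; false; if_then_else_; not; _∧_)
open import Data.Vec using (lookup)
open import Data.List using (List; []; _∷_; _++_)
open import Data.List.Membership.DecPropositional as Mem using ()
open import Data.Integer using (+_)
open import Data.Rational using (ℚ; _/_; _*_; _+_; _≤_; _<_; 0ℚ; 1ℚ)
open import Data.Product using (_×_)
open import Relation.Binary.PropositionalEquality using (_≡_; refl)
open import Relation.Nullary.Decidable using (does)

⟦_⟧ : ℕ → ℚ
⟦ k ⟧ = + k / 1

sumFin : {n : ℕ} → (Fin n → ℕ) → ℕ
sumFin {zero}  f = 0
sumFin {suc n} f = f zero ℕ.+ sumFin (λ i → f (suc i))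

countFin : {n : ℕ} → (Fin n → Bool) → ℕ
countFin p = sumFin (λ i → if p i then 1 else 0)

record Graph (n : ℕ) : Set where
  field
    m    : ℕ
    tail : Fin m → Fin n
    head : Fin m → Fin n
open Graph public

rev : {n : ℕ} → Graph n → Graph n
rev G = record { m = m G ; tail = head G ; head = tail G }

-- degree: number of incident edges, a self-loop counts twice
deg : {n : ℕ} → Graph n → Fin n → ℕ
deg G v = countFin (λ e → does (tail G e ≟ v)) ℕ.+ countFin (λ e → does (head G e ≟ v))

VVec : ℕ → Set
VVec n = Fin n → ℕ

zeroVec : {n : ℕ} → VVec n
zeroVec _ = 0

_⟨_⟩ : {n : ℕ} → VVec n → Subset n → ℕ
r ⟨ S ⟩ = sumFin (λ v → if lookup S v then r v else 0)

‖_‖₁ : {n : ℕ} → VVec n → ℕ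
‖ r ‖₁ = sumFin r

vol : {n : ℕ} → Graph n → Subset n → ℕ
vol G S = deg G ⟨ S ⟩

cutOut : {n : ℕ} → Graph n → Subset n → ℕ
cutOut G S = countFin (λ e → lookup S (tail G e) ∧ not (lookup S (head G e)))

OutSparse : {n : ℕ} → Graph n → ℚ → Subset n → Set
OutSparse G φ S = (vol G S ℕ.≤ vol G (∁ S)) × (⟦ cutOut G S ⟧ < φ * ⟦ vol G S ⟧)

IsExpander : {n : ℕ} → Graph n → ℚ → Set
IsExpander G φ = ((S : Subset _) → OutSparse G φ S → Data.Empty.⊥)
               × ((S : Subset _) → OutSparse (rev G) φ S → Data.Empty.⊥)
  where import Data.Empty

data Path {n : ℕ} (G : Graph n) : Fin n → Fin n → Set where
  []  : {u : Fin n} → Path G u u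
  _∷_ : {v : Fin n} (e : Fin (m G)) → Path G (head G e) v → Path G (tail G e) v

edgesOf : {n : ℕ} {G : Graph n} {u v : Fin n} → Path G u v → List (Fin (m G))
edgesOf []      = []
edgesOf (e ∷ p) = e ∷ edgesOf p

_++ᴾ_ : {n : ℕ} {G : Graph n} {u v w : Fin n} → Path G u v → Path G v w → Path G u w
[]      ++ᴾ q = q
(e ∷ p) ++ᴾ q = e ∷ (p ++ᴾ q)

revPath : {n : ℕ} {G : Graph n} {u v : Fin n} → Path G u v → Path (rev G) v u
revPath []      = []
revPath (e ∷ p) = revPath p ++ᴾ (e ∷ [])

Embedding : {n : ℕ} → Graph n → Graph n → Set
Embedding W G = (f : Fin (m W)) → Path G (tail W f) (head W f)

revEmbedding : {n : ℕ} {W G : Graph n} → Embedding W G → Embedding (rev W) (rev G)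
revEmbedding Π f = revPath (Π f)

load : {n : ℕ} {W G : Graph n} → Embedding W G → Fin (m G) → ℕ
load {G = G} Π e = countFin (λ f → does (e ∈? edgesOf (Π f)))
  where open Mem (_≟_ {m G}) using (_∈?_)

record IsOutWitness {n : ℕ} (G W : Graph n) (Π : Embedding W G)
                    (r γ : VVec n) (R : ℕ) (φ ψ : ℚ) : Set where
  field
    normBound  : ‖ r ‖₁ ℕ.≤ R
    degLower   : (v : Fin n) → deg G v ℕ.≤ deg W v ℕ.+ r v
    degUpper   : (v : Fin n) → ψ * ⟦ deg W v ℕ.+ r v ⟧ ≤ ⟦ deg G v ⟧
    expansion  : (S : Subset n) → γ ⟨ S ⟩ ℕ.≤ γ ⟨ ∁ S ⟩ →
                 ψ * ⟦ vol W S ℕ.+ r ⟨ S ⟩ ⟧ ≤ ⟦ cutOut W S ℕ.+ r ⟨ S ⟩ ⟧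
    congestion : (e : Fin (m G)) → (ψ * φ) * ⟦ load Π e ⟧ ≤ 1ℚ

record IsWitness {n : ℕ} (G W : Graph n) (Π : Embedding W G)
                 (r γ : VVec n) (R : ℕ) (φ ψ : ℚ) : Set where
  field
    out : IsOutWitness G W Π r γ R φ ψ
    inn : IsOutWitness (rev G) (rev W) (revEmbedding Π) r γ R φ ψ

-- A sparse cut (S, S̄) of G is also sparse in W: by the degree condition vol_G S ≤ vol_W S, and
-- vol_G S ≤ vol_G S̄ ≤ vol_W S̄, so whichever side is γ-lighter expands in W (for S̄ one uses the
-- reversed witness, whose out-cut at S̄ is the out-cut of W at S). Hence ψ vol_G S ≤ |E_W(S, S̄)|.
-- Every W-edge leaving S is embedded into a G-path leaving S, which contains an edge of
-- E_G(S, S̄); since each G-edge carries at most 1/(ψφ) paths, |E_W(S, S̄)| ≤ |E_G(S, S̄)| / (ψφ).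
module Submission where

open import Defs
open import Data.Nat as ℕ using (ℕ; zero; suc; z≤n)
import Data.Nat.Properties as ℕ
open import Data.Integer using (+_; +≤+)
import Data.Integer.Properties as ℤ
open import Data.Rational using (ℚ; mkℚ; _*_; _+_; _≤_; _<_; *≤*; 0ℚ; 1ℚ; NonNegative; nonNegative)
import Data.Rational.Properties as ℚ
open import Data.Nat.Coprimality using (1-coprimeTo)
import Data.Nat.Coprimality as Coprime
open import Data.Fin using (Fin; zero; suc; _≟_)
open import Data.Fin.Subset using (Subset; ∁)
open import Data.Bool using (Bool; true; false; if_then_else_; not; _∧_)
open import Data.Bool.Properties using (not-involutive; ∧-comm)
open import Data.Vec using (lookup)
open import Data.Vec.Properties using (lookup-map)
open import Data.List.Membership.Propositional using (_∈_)
open import Data.List.Relation.Unary.Any using (here; there)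
import Data.List.Membership.DecPropositional as DecMembership
open import Data.Product using (∃; _×_; _,_)
open import Function using (_∘_)
open import Relation.Nullary using (¬_; yes; no)
open import Relation.Nullary.Decidable using (does; dec-true)
open import Relation.Binary.PropositionalEquality
import Algebra.Solver.CommutativeMonoid as CommutativeMonoidSolver
open import Algebra.Properties.CommutativeSemigroup ℕ.+-commutativeSemigroup
  using () renaming (interchange to +-interchange)

⟦⟧≡mkℚ : ∀ k → ⟦ k ⟧ ≡ mkℚ (+ k) 0 (Coprime.sym (1-coprimeTo k))
⟦⟧≡mkℚ k = ℚ.normalize-coprime (Coprime.sym (1-coprimeTo k))

⟦⟧-+ : ∀ a b → ⟦ a ℕ.+ b ⟧ ≡ ⟦ a ⟧ + ⟦ b ⟧
⟦⟧-+ a b rewrite ⟦⟧≡mkℚ a | ⟦⟧≡mkℚ b | ℕ.*-identityʳ a | ℕ.*-identityʳ b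
               | ℤ.+◃n≡+n a | ℤ.+◃n≡+n b = refl

⟦⟧-mono-≤ : ∀ {a b} → a ℕ.≤ b → ⟦ a ⟧ ≤ ⟦ b ⟧
⟦⟧-mono-≤ {a} {b} a≤b rewrite ⟦⟧≡mkℚ a | ⟦⟧≡mkℚ b = *≤* (ℤ.*-monoʳ-≤-nonNeg (+ 1) (+≤+ a≤b))

sumFin-zero : ∀ k → sumFin {k} (λ _ → 0) ≡ 0
sumFin-zero zero    = refl
sumFin-zero (suc k) = sumFin-zero k

sumFin-cong : ∀ {k} {f g : Fin k → ℕ} → (∀ i → f i ≡ g i) → sumFin f ≡ sumFin g
sumFin-cong {zero}  f≗g = refl
sumFin-cong {suc k} f≗g = cong₂ ℕ._+_ (f≗g zero) (sumFin-cong (f≗g ∘ suc))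

sumFin-mono-≤ : ∀ {k} {f g : Fin k → ℕ} → (∀ i → f i ℕ.≤ g i) → sumFin f ℕ.≤ sumFin g
sumFin-mono-≤ {zero}  f≤g = z≤n
sumFin-mono-≤ {suc k} f≤g = ℕ.+-mono-≤ (f≤g zero) (sumFin-mono-≤ (f≤g ∘ suc))

sumFin-distrib-+ : ∀ {k} (f g : Fin k → ℕ) →
                   sumFin (λ i → f i ℕ.+ g i) ≡ sumFin f ℕ.+ sumFin g
sumFin-distrib-+ {zero}  f g = refl
sumFin-distrib-+ {suc k} f g =
  trans (cong (f zero ℕ.+ g zero ℕ.+_) (sumFin-distrib-+ (f ∘ suc) (g ∘ suc)))
        (+-interchange (f zero) (g zero) (sumFin (f ∘ suc)) (sumFin (g ∘ suc)))

sumFin-comm : ∀ {a b} (F : Fin a → Fin b → ℕ) →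
              sumFin (λ i → sumFin (F i)) ≡ sumFin (λ j → sumFin (λ i → F i j))
sumFin-comm {zero}  {b} F = sym (sumFin-zero b)
sumFin-comm {suc a}     F =
  trans (cong (sumFin (F zero) ℕ.+_) (sumFin-comm (F ∘ suc)))
        (sym (sumFin-distrib-+ (F zero) (λ j → sumFin (λ i → F (suc i) j))))

term≤sumFin : ∀ {k} (f : Fin k → ℕ) i → f i ℕ.≤ sumFin f
term≤sumFin f zero    = ℕ.m≤m+n (f zero) _
term≤sumFin f (suc i) = ℕ.≤-trans (term≤sumFin (f ∘ suc) i) (ℕ.m≤n+m _ (f zero))

sumFin-if : ∀ {k} (c : Bool) (f : Fin k → ℕ) →
            sumFin (λ i → if c then f i else 0) ≡ (if c then sumFin f else 0)
sumFin-if     true  f = refl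
sumFin-if {k} false f = sumFin-zero k

*-sumFin-≤ : ∀ {k} c .{{_ : NonNegative c}} (f g : Fin k → ℕ) →
             (∀ i → c * ⟦ f i ⟧ ≤ ⟦ g i ⟧) → c * ⟦ sumFin f ⟧ ≤ ⟦ sumFin g ⟧
*-sumFin-≤ {zero}  c f g cf≤g = ℚ.≤-reflexive (ℚ.*-zeroʳ c)
*-sumFin-≤ {suc k} c f g cf≤g
  rewrite ⟦⟧-+ (f zero) (sumFin (f ∘ suc)) | ⟦⟧-+ (g zero) (sumFin (g ∘ suc))
        | ℚ.*-distribˡ-+ c ⟦ f zero ⟧ ⟦ sumFin (f ∘ suc) ⟧
  = ℚ.+-mono-≤ (cf≤g zero) (*-sumFin-≤ c (f ∘ suc) (g ∘ suc) (cf≤g ∘ suc))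

lookup-∁ : ∀ {n} (S : Subset n) v → lookup (∁ S) v ≡ not (lookup S v)
lookup-∁ S v = lookup-map v not S

zeroVec⟨⟩ : ∀ {n} (S : Subset n) → zeroVec ⟨ S ⟩ ≡ 0
zeroVec⟨⟩ {n} S = trans (sumFin-cong (if-0 ∘ lookup S)) (sumFin-zero n)
  where
  if-0 : ∀ b → (if b then 0 else 0) ≡ 0
  if-0 true  = refl
  if-0 false = refl

⟨∁∁⟩ : ∀ {n} (γ : VVec n) (S : Subset n) → γ ⟨ ∁ (∁ S) ⟩ ≡ γ ⟨ S ⟩
⟨∁∁⟩ γ S = sumFin-cong λ v → cong (λ b → if b then γ v else 0)
  (trans (lookup-∁ (∁ S) v) (trans (cong not (lookup-∁ S v)) (not-involutive _)))

vol-rev : ∀ {n} (W : Graph n) (S : Subset n) → vol (rev W) S ≡ vol W S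
vol-rev W S = sumFin-cong λ v → cong (λ d → if lookup S v then d else 0)
  (ℕ.+-comm (countFin (λ e → does (head W e ≟ v))) _)

crossing : ∀ {n} (G : Graph n) (S : Subset n) → Fin (m G) → Bool
crossing G S e = lookup S (tail G e) ∧ not (lookup S (head G e))

crossing-rev-∁ : ∀ {n} (W : Graph n) (S : Subset n) e → crossing (rev W) (∁ S) e ≡ crossing W S e
crossing-rev-∁ W S e = begin
  lookup (∁ S) (head W e) ∧ not (lookup (∁ S) (tail W e)) ≡⟨ cong₂ _∧_ (lookup-∁ S _) (cong not (lookup-∁ S _)) ⟩
  not h ∧ not (not t)                                     ≡⟨ cong (not h ∧_) (not-involutive t) ⟩
  not h ∧ t                                               ≡⟨ ∧-comm (not h) t ⟩
  t ∧ not h                                               ∎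
  where
  open ≡-Reasoning
  h = lookup S (head W e)
  t = lookup S (tail W e)

cutOut-rev-∁ : ∀ {n} (W : Graph n) (S : Subset n) → cutOut (rev W) (∁ S) ≡ cutOut W S
cutOut-rev-∁ W S = sumFin-cong (cong (λ b → if b then 1 else 0) ∘ crossing-rev-∁ W S)

vol-mono : ∀ {n} (G W : Graph n) → (∀ v → deg G v ℕ.≤ deg W v) → ∀ S → vol G S ℕ.≤ vol W S
vol-mono G W degG≤degW S = sumFin-mono-≤ λ v → if-mono (lookup S v) v
  where
  if-mono : ∀ b v → (if b then deg G v else 0) ℕ.≤ (if b then deg W v else 0)
  if-mono true  v = degG≤degW v
  if-mono false v = z≤n

∧-not-true : ∀ a b → a ∧ not b ≡ true → (a ≡ true) × (b ≡ false)
∧-not-true true false _ = refl , refl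

path-crosses : ∀ {n} (G : Graph n) (S : Subset n) {u v} (p : Path G u v) →
               lookup S u ≡ true → lookup S v ≡ false →
               ∃ λ e → e ∈ edgesOf p × crossing G S e ≡ true
path-crosses G S []      u∈S v∉S with () ← trans (sym u∈S) v∉S
path-crosses G S (e ∷ p) u∈S v∉S with lookup S (head G e) in w∈S
... | false = e , here refl , cong₂ _∧_ u∈S (cong not w∈S)
... | true  with path-crosses G S p w∈S v∉S
...   | e′ , e′∈p , e′-crossing = e′ , there e′∈p , e′-crossing

module _ {n} {W G : Graph n} (Π : Embedding W G) (S : Subset n) where
  open DecMembership (_≟_ {m G}) using (_∈?_)

  routes : Fin (m W) → Fin (m G) → ℕ
  routes f e = if does (e ∈? edgesOf (Π f)) then 1 else 0

  routedThrough : Fin (m W) → Fin (m G) → ℕ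
  routedThrough f e = if crossing G S e then routes f e else 0

  crossing-routedThrough : ∀ f → (if crossing W S f then 1 else 0) ℕ.≤ sumFin (routedThrough f)
  crossing-routedThrough f with crossing W S f in f-crossing
  ... | false = z≤n
  ... | true  with ∧-not-true (lookup S (tail W f)) _ f-crossing
  ...   | t∈S , h∉S with path-crosses G S (Π f) t∈S h∉S
  ...     | e , e∈Πf , e-crossing = ℕ.≤-trans (ℕ.≤-reflexive (sym routed)) (term≤sumFin (routedThrough f) e)
    where
    routed : routedThrough f e ≡ 1
    routed rewrite e-crossing | dec-true (e ∈? edgesOf (Π f)) e∈Πf = refl

  cutOut≤crossingLoad : cutOut W S ℕ.≤ sumFin (λ e → if crossing G S e then load Π e else 0)
  cutOut≤crossingLoad = begin
    cutOut W S                                              ≤⟨ sumFin-mono-≤ crossing-routedThrough ⟩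
    sumFin (λ f → sumFin (routedThrough f))                 ≡⟨ sumFin-comm routedThrough ⟩
    sumFin (λ e → sumFin (λ f → routedThrough f e))         ≡⟨ sumFin-cong (λ e → sumFin-if (crossing G S e) (λ f → routes f e)) ⟩
    sumFin (λ e → if crossing G S e then load Π e else 0)   ∎
    where open ℕ.≤-Reasoning

  cutOut-congestion : ∀ c .{{_ : NonNegative c}} → (∀ e → c * ⟦ load Π e ⟧ ≤ 1ℚ) →
                      c * ⟦ cutOut W S ⟧ ≤ ⟦ cutOut G S ⟧
  cutOut-congestion c c*load≤1 = ℚ.≤-trans (ℚ.*-monoˡ-≤-nonNeg c (⟦⟧-mono-≤ cutOut≤crossingLoad))
    (*-sumFin-≤ c _ _ λ e → if-bound (crossing G S e) e)
    where
    if-bound : ∀ b e → c * ⟦ if b then load Π e else 0 ⟧ ≤ ⟦ if b then 1 else 0 ⟧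
    if-bound true  e = c*load≤1 e
    if-bound false e = ℚ.≤-reflexive (ℚ.*-zeroʳ c)

Expands : ∀ {n} → ℚ → VVec n → Graph n → Set
Expands ψ γ W = ∀ S → γ ⟨ S ⟩ ℕ.≤ γ ⟨ ∁ S ⟩ → ψ * ⟦ vol W S ⟧ ≤ ⟦ cutOut W S ⟧

module _ {n} {G W : Graph n} {Π : Embedding W G} {γ : VVec n} {R : ℕ} {φ ψ : ℚ}
         (out : IsOutWitness G W Π zeroVec γ R φ ψ) where
  open IsOutWitness out

  deg≤deg-witness : ∀ v → deg G v ℕ.≤ deg W v
  deg≤deg-witness v = subst (deg G v ℕ.≤_) (ℕ.+-identityʳ (deg W v)) (degLower v)

  expands-witness : Expands ψ γ W
  expands-witness S γS≤γ∁S = subst₂ (λ a b → ψ * a ≤ b) (drop-zeroVec (vol W S)) (drop-zeroVec (cutOut W S))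
                                    (expansion S γS≤γ∁S)
    where
    drop-zeroVec : ∀ a → ⟦ a ℕ.+ zeroVec ⟨ S ⟩ ⟧ ≡ ⟦ a ⟧
    drop-zeroVec a = cong ⟦_⟧ (trans (cong (a ℕ.+_) (zeroVec⟨⟩ S)) (ℕ.+-identityʳ a))

vol≤cutOut : ∀ {n} (G W : Graph n) {γ : VVec n} (ψ : ℚ) .{{_ : NonNegative ψ}} →
             Expands ψ γ W → Expands ψ γ (rev W) → (∀ v → deg G v ℕ.≤ deg W v) →
             ∀ S → vol G S ℕ.≤ vol G (∁ S) → ψ * ⟦ vol G S ⟧ ≤ ⟦ cutOut W S ⟧
vol≤cutOut G W {γ} ψ expandsW expandsWᵣ degG≤degW S volS≤vol∁S
  with γ ⟨ S ⟩ ℕ.≤? γ ⟨ ∁ S ⟩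
... | yes γS≤γ∁S = ℚ.≤-trans (ℚ.*-monoˡ-≤-nonNeg ψ (⟦⟧-mono-≤ (vol-mono G W degG≤degW S)))
                             (expandsW S γS≤γ∁S)
... | no  γS≰γ∁S = ℚ.≤-trans (ℚ.*-monoˡ-≤-nonNeg ψ (⟦⟧-mono-≤ volS≤volW∁S))
                             (subst₂ (λ a b → ψ * ⟦ a ⟧ ≤ ⟦ b ⟧) (vol-rev W (∁ S)) (cutOut-rev-∁ W S)
                                     (expandsWᵣ (∁ S) γ∁S≤γ∁∁S))
  where
  volS≤volW∁S : vol G S ℕ.≤ vol W (∁ S)
  volS≤volW∁S = ℕ.≤-trans volS≤vol∁S (vol-mono G W degG≤degW (∁ S))
  γ∁S≤γ∁∁S : γ ⟨ ∁ S ⟩ ℕ.≤ γ ⟨ ∁ (∁ S) ⟩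
  γ∁S≤γ∁∁S = subst (γ ⟨ ∁ S ⟩ ℕ.≤_) (sym (⟨∁∁⟩ γ S)) (ℕ.≰⇒≥ γS≰γ∁S)

ψφ*ψ≡ψψφ : ∀ ψ φ x → (ψ * φ) * (ψ * x) ≡ ((ψ * ψ) * φ) * x
ψφ*ψ≡ψψφ = solve 3 (λ ψ φ x → (ψ ⊕ φ) ⊕ (ψ ⊕ x) ⊜ ((ψ ⊕ ψ) ⊕ φ) ⊕ x) refl
  where open CommutativeMonoidSolver ℚ.*-1-commutativeMonoid

no-outSparse : ∀ {n} {G W : Graph n} {Π : Embedding W G} {γ : VVec n} {R : ℕ} {φ ψ : ℚ} →
               0ℚ < φ → 0ℚ < ψ → IsOutWitness G W Π zeroVec γ R φ ψ → Expands ψ γ (rev W) →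
               ∀ S → ¬ OutSparse G ((ψ * ψ) * φ) S
no-outSparse {G = G} {W} {Π} {φ = φ} {ψ} 0<φ 0<ψ out expandsWᵣ S (volS≤vol∁S , sparse) =
  ℚ.<-irrefl refl (ℚ.≤-<-trans ψφ*ψ*vol≤cut (subst (⟦ cutOut G S ⟧ <_) (sym (ψφ*ψ≡ψψφ ψ φ _)) sparse))
  where
  instance
    ψ≥0 : NonNegative ψ
    ψ≥0 = nonNegative (ℚ.<⇒≤ 0<ψ)
    φ≥0 : NonNegative φ
    φ≥0 = nonNegative (ℚ.<⇒≤ 0<φ)
    ψφ≥0 : NonNegative (ψ * φ)
    ψφ≥0 = ℚ.nonNeg*nonNeg⇒nonNeg ψ φ

  ψφ*ψ*vol≤cut : (ψ * φ) * (ψ * ⟦ vol G S ⟧) ≤ ⟦ cutOut G S ⟧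
  ψφ*ψ*vol≤cut = ℚ.≤-trans
    (ℚ.*-monoˡ-≤-nonNeg (ψ * φ)
      (vol≤cutOut G W ψ (expands-witness out) expandsWᵣ (deg≤deg-witness out) S volS≤vol∁S))
    (cutOut-congestion Π S (ψ * φ) (IsOutWitness.congestion out))

claim2p2 : {n : ℕ} (G : Graph n) (R : ℕ) (φ ψ : ℚ) (γ : VVec n) →
           0ℚ < φ → φ < 1ℚ → 0ℚ < ψ → ψ < 1ℚ →
           (W : Graph n) (Π : Embedding W G) →
           IsWitness G W Π zeroVec γ R φ ψ →
           IsExpander G ((ψ * ψ) * φ)
claim2p2 G R φ ψ γ 0<φ _ 0<ψ _ W Π witness =
  no-outSparse 0<φ 0<ψ out (expands-witness inn) , no-outSparse 0<φ 0<ψ inn (expands-witness out)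
  where open IsWitness witness
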